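{- If the theory U is consistent, then for every primitive recursive relation R of arity n on the tree language L and for all trees t_1,...,t_n in L we have: R(t_1,...,t_n) holds if and only if U ⊢ ⌜R⌝(⌜t_1⌝,...,⌜t_n⌝). In particular, for all trees t_1, t_2 in L: t_1 = t_2 if and only if U ⊢ ⌜t_1 = t_2⌝.
   Context: L is a language of trees: the algebra of closed terms generated by finitely many constructors c_1,...,c_N of arities k_1,...,k_N, among which a constant 0 and a unary constructor s used to encode natural numbers. S is the one-sorted first-order "theory of syntactic constructions" whose function symbols are the constructors c_1,...,c_N plus, for each primitive recursive definition of an n-ary function on trees, an n-ary function symbol; its only predicate symbol is equality; its axioms are the equality axioms (reflexivity, symmetry, transitivity, congruence for every function symbol), injectivity of each constructor (c_i(x_1,...,x_{k_i}) = c_i(y_1,...,y_{k_i}) → x_1=y_1 ∧ ... ∧ x_{k_i}=y_{k_i}), non-confusion of distinct constructors (c_i(...) = c_j(...) → ⊥ for i ≠ j), the defining equations of each primitive recursive function symbol, and the induction scheme ⋀_{i=1}^N (∀x_1...∀x_{k_i} A(c_i(x_1,...,x_{k_i}))) → ∀x A(x) for every formula A. The theory U "expresses syntactic constructions": it comes with an interpretation of S into U, written with corner brackets ⌜·⌝ ("the code of"), which is structural on terms and formulas. An interpretation of a theory T into a theory U maps each sort of T to a sort of U together with a relativization predicate that is provably inhabited in U, maps variables to variables and formulas A of T to formulas A* of U, such that U proves ⊥* ↔ ⊥, ⊤* ↔ ⊤, and (under the relativization hypotheses on the free variables) that the translation commutes with ∧, ∨, → and with ∀, ∃ relativized to the relativization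 predicate, and such that U proves the translation of every axiom of T; being structural on terms means it also comes with a translation of terms such that translated terms satisfy the relativization predicate (under the relativization hypotheses on their free variables) and each function symbol is translated as a macro, i.e. the translation of f(t_1,...,t_n) is the translation of f(x_1,...,x_n) with the translations of t_1,...,t_n substituted for the translated variables. For a tree t in L, ⌜t⌝ denotes its code in U (the translation of the closed S-term denoting t). Each primitive recursive relation R of arity n on L is expressed in S as R(x_1,...,x_n) ≡ f(x_1,...,x_n) = 1, where f is the function symbol of S associated with the characteristic function of R; via the interpretation ⌜·⌝ it is represented in U by the formula ⌜R⌝(x_1,...,x_n). -}

module Defs where

open import Data.Nat using (ℕ; zero; suc; _+_)
open import Data.Fin using (Fin; zero; suc)
open import Data.List using (List; []; _∷_; _++_; map; replicate; allFin)
open import Data.List.Membership.Propositional using (_∈_)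
open import Data.Vec using (Vec; []; _∷_; lookup) renaming (_++_ to _++ᵛ_; map to mapᵛ)
open import Data.Unit using (⊤; tt)
open import Data.Sum using (_⊎_; inj₁; inj₂)
open import Data.Product using (Σ; _,_)
open import Relation.Binary.PropositionalEquality using (_≡_; _≢_)
open import Relation.Nullary using (¬_)

-- Many-sorted first-order signatures (no built-in equality)

record Signature : Set₁ where
  field
    Sort : Set
    Fun  : Set
    dom  : Fun → List Sort
    cod  : Fun → Sort
    Pred : Set
    pdom : Pred → List Sort

-- Underlying logic of a theory (the result is stated for both).
data Logic : Set where
  intuitionistic classical : Logic

module FOL (Sg : Signature) where
  open Signature Sg

  Ctx : Set
  Ctx = List Sort

  -- de Bruijn variables; the head of the context is the innermost variable
  data Var : Ctx → Sort → Set where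
    here  : ∀ {s Γ} → Var (s ∷ Γ) s
    there : ∀ {s t Γ} → Var Γ s → Var (t ∷ Γ) s

  mutual
    data Term (Γ : Ctx) : Sort → Set where
      var : ∀ {s} → Var Γ s → Term Γ s
      app : (f : Fun) → Terms Γ (dom f) → Term Γ (cod f)

    data Terms (Γ : Ctx) : List Sort → Set where
      []  : Terms Γ []
      _∷_ : ∀ {s ss} → Term Γ s → Terms Γ ss → Terms Γ (s ∷ ss)

  infixr 6 _∧'_
  infixr 5 _∨'_
  infixr 4 _⇒'_

  data Form (Γ : Ctx) : Set where
    atom : (p : Pred) → Terms Γ (pdom p) → Form Γ
    ⊥' ⊤' : Form Γ
    _∧'_ _∨'_ _⇒'_ : Form Γ → Form Γ → Form Γ
    ∀' ∃' : (s : Sort) → Form (s ∷ Γ) → Form Γ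

  ¬' : ∀ {Γ} → Form Γ → Form Γ
  ¬' A = A ⇒' ⊥'

  Ren : Ctx → Ctx → Set
  Ren Γ Δ = ∀ {s} → Var Γ s → Var Δ s

  liftR : ∀ {Γ Δ s} → Ren Γ Δ → Ren (s ∷ Γ) (s ∷ Δ)
  liftR ρ here      = here
  liftR ρ (there v) = there (ρ v)

  mutual
    renT : ∀ {Γ Δ s} → Ren Γ Δ → Term Γ s → Term Δ s
    renT ρ (var v)    = var (ρ v)
    renT ρ (app f ts) = app f (renTs ρ ts)

    renTs : ∀ {Γ Δ ss} → Ren Γ Δ → Terms Γ ss → Terms Δ ss
    renTs ρ []       = []
    renTs ρ (t ∷ ts) = renT ρ t ∷ renTs ρ ts

  renF : ∀ {Γ Δ} → Ren Γ Δ → Form Γ → Form Δ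
  renF ρ (atom p ts) = atom p (renTs ρ ts)
  renF ρ ⊥'         = ⊥'
  renF ρ ⊤'         = ⊤'
  renF ρ (A ∧' B)   = renF ρ A ∧' renF ρ B
  renF ρ (A ∨' B)   = renF ρ A ∨' renF ρ B
  renF ρ (A ⇒' B)   = renF ρ A ⇒' renF ρ B
  renF ρ (∀' s A)   = ∀' s (renF (liftR ρ) A)
  renF ρ (∃' s A)   = ∃' s (renF (liftR ρ) A)

  wkF : ∀ {Γ s} → Form Γ → Form (s ∷ Γ)
  wkF = renF there

  emptyRen : ∀ {Γ} → Ren [] Γ
  emptyRen ()

  closedWk : ∀ {Γ} → Form [] → Form Γ
  closedWk = renF emptyRen

  Sub : Ctx → Ctx → Set
  Sub Γ Δ = ∀ {s} → Var Γ s → Term Δ s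

  liftS : ∀ {Γ Δ s} → Sub Γ Δ → Sub (s ∷ Γ) (s ∷ Δ)
  liftS σ here      = var here
  liftS σ (there v) = renT there (σ v)

  mutual
    subT : ∀ {Γ Δ s} → Sub Γ Δ → Term Γ s → Term Δ s
    subT σ (var v)    = σ v
    subT σ (app f ts) = app f (subTs σ ts)

    subTs : ∀ {Γ Δ ss} → Sub Γ Δ → Terms Γ ss → Terms Δ ss
    subTs σ []       = []
    subTs σ (t ∷ ts) = subT σ t ∷ subTs σ ts

  subF : ∀ {Γ Δ} → Sub Γ Δ → Form Γ → Form Δ
  subF σ (atom p ts) = atom p (subTs σ ts)
  subF σ ⊥'         = ⊥'
  subF σ ⊤'         = ⊤'
  subF σ (A ∧' B)   = subF σ A ∧' subF σ B
  subF σ (A ∨' B)   = subF σ A ∨' subF σ B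
  subF σ (A ⇒' B)   = subF σ A ⇒' subF σ B
  subF σ (∀' s A)   = ∀' s (subF (liftS σ) A)
  subF σ (∃' s A)   = ∃' s (subF (liftS σ) A)

  σ₀ : ∀ {Γ s} → Term Γ s → Sub (s ∷ Γ) Γ
  σ₀ t here      = t
  σ₀ t (there v) = var v

  sub0 : ∀ {Γ s} → Form (s ∷ Γ) → Term Γ s → Form Γ
  sub0 A t = subF (σ₀ t) A

  tmsSub : ∀ {Δ ss} → Terms Δ ss → Sub ss Δ
  tmsSub (t ∷ ts) here      = t
  tmsSub (t ∷ ts) (there v) = tmsSub ts v

  closeAll : (Γ : Ctx) → Form Γ → Form []
  closeAll []      A = A
  closeAll (s ∷ Γ) A = closeAll Γ (∀' s A)

  ∀* : ∀ {Γ} (Δ : Ctx) → Form (Δ ++ Γ) → Form Γ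
  ∀* []      A = A
  ∀* (s ∷ Δ) A = ∀* Δ (∀' s A)

  injL : ∀ {Δ Γ s} → Var Δ s → Var (Δ ++ Γ) s
  injL here      = here
  injL (there v) = there (injL v)

  injR : ∀ {Γ s} (Δ : Ctx) → Var Γ s → Var (Δ ++ Γ) s
  injR []      v = v
  injR (t ∷ Δ) v = there (injR Δ v)

  module Proofs (lg : Logic) (Ax : Form [] → Set) where
    data Deriv : (Γ : Ctx) → List (Form Γ) → Form Γ → Set where
      hyp : ∀ {Γ Δ A} → A ∈ Δ → Deriv Γ Δ A
      ax  : ∀ {Γ Δ A} → Ax A → Deriv Γ Δ (closedWk A)
      ⊤I  : ∀ {Γ Δ} → Deriv Γ Δ ⊤'
      ⊥E  : ∀ {Γ Δ A} → Deriv Γ Δ ⊥' → Deriv Γ Δ A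
      ∧I  : ∀ {Γ Δ A B} → Deriv Γ Δ A → Deriv Γ Δ B → Deriv Γ Δ (A ∧' B)
      ∧E₁ : ∀ {Γ Δ A B} → Deriv Γ Δ (A ∧' B) → Deriv Γ Δ A
      ∧E₂ : ∀ {Γ Δ A B} → Deriv Γ Δ (A ∧' B) → Deriv Γ Δ B
      ∨I₁ : ∀ {Γ Δ A B} → Deriv Γ Δ A → Deriv Γ Δ (A ∨' B)
      ∨I₂ : ∀ {Γ Δ A B} → Deriv Γ Δ B → Deriv Γ Δ (A ∨' B)
      ∨E  : ∀ {Γ Δ A B C} → Deriv Γ Δ (A ∨' B) → Deriv Γ (A ∷ Δ) C →
            Deriv Γ (B ∷ Δ) C → Deriv Γ Δ C
      ⇒I  : ∀ {Γ Δ A B} → Deriv Γ (A ∷ Δ) B → Deriv Γ Δ (A ⇒' B)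
      ⇒E  : ∀ {Γ Δ A B} → Deriv Γ Δ (A ⇒' B) → Deriv Γ Δ A → Deriv Γ Δ B
      ∀I  : ∀ {Γ Δ s A} → Deriv (s ∷ Γ) (map wkF Δ) A → Deriv Γ Δ (∀' s A)
      ∀E  : ∀ {Γ Δ s A} → Deriv Γ Δ (∀' s A) → (t : Term Γ s) →
            Deriv Γ Δ (sub0 A t)
      ∃I  : ∀ {Γ Δ s A} (t : Term Γ s) → Deriv Γ Δ (sub0 A t) →
            Deriv Γ Δ (∃' s A)
      ∃E  : ∀ {Γ Δ s A B} → Deriv Γ Δ (∃' s A) →
            Deriv (s ∷ Γ) (A ∷ map wkF Δ) (wkF B) → Deriv Γ Δ B
      dne : ∀ {Γ Δ A} → lg ≡ classical → Deriv Γ Δ (¬' (¬' A)) → Deriv Γ Δ A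

record Theory : Set₁ where
  field
    sig   : Signature
    logic : Logic
    Ax    : FOL.Form sig [] → Set

infix 2 _⊢_
_⊢_ : (U : Theory) → FOL.Form (Theory.sig U) [] → Set
U ⊢ A = FOL.Proofs.Deriv (Theory.sig U) (Theory.logic U) (Theory.Ax U) [] [] A

Consistent : Theory → Set
Consistent U = ¬ (U ⊢ FOL.⊥' {Theory.sig U})

module Interp (T U : Signature) where
  private
    module TT = FOL T
    module UU = FOL U
  open Signature

  record InterpData : Set where
    field
      sortMap : Sort T → Sort U
      rel     : (s : Sort T) → UU.Form (sortMap s ∷ [])
      funTr   : (f : Fun T) → UU.Term (map sortMap (dom T f)) (sortMap (cod T f))
      predTr  : (p : Pred T) → UU.Form (map sortMap (pdom T p))

  module Translate (D : InterpData) where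
    open InterpData D

    trCtx : TT.Ctx → UU.Ctx
    trCtx = map sortMap

    trVar : ∀ {Γ s} → TT.Var Γ s → UU.Var (trCtx Γ) (sortMap s)
    trVar TT.here      = UU.here
    trVar (TT.there v) = UU.there (trVar v)

    mutual
      trT : ∀ {Γ s} → TT.Term Γ s → UU.Term (trCtx Γ) (sortMap s)
      trT (TT.var v)    = UU.var (trVar v)
      trT (TT.app f ts) = UU.subT (UU.tmsSub (trTs ts)) (funTr f)

      trTs : ∀ {Γ ss} → TT.Terms Γ ss → UU.Terms (trCtx Γ) (map sortMap ss)
      trTs TT.[]       = UU.[]
      trTs (t TT.∷ ts) = trT t UU.∷ trTs ts

    ren0 : ∀ {s Δ} → UU.Ren (s ∷ []) (s ∷ Δ)
    ren0 UU.here = UU.here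

    relHere : ∀ {Δ} (s : Sort T) → UU.Form (sortMap s ∷ Δ)
    relHere s = UU.renF ren0 (rel s)

    trF : ∀ {Γ} → TT.Form Γ → UU.Form (trCtx Γ)
    trF (TT.atom p ts) = UU.subF (UU.tmsSub (trTs ts)) (predTr p)
    trF TT.⊥'         = UU.⊥'
    trF TT.⊤'         = UU.⊤'
    trF (A TT.∧' B)   = trF A UU.∧' trF B
    trF (A TT.∨' B)   = trF A UU.∨' trF B
    trF (A TT.⇒' B)   = trF A UU.⇒' trF B
    trF (TT.∀' s A)   = UU.∀' (sortMap s) (relHere s UU.⇒' trF A)
    trF (TT.∃' s A)   = UU.∃' (sortMap s) (relHere s UU.∧' trF A)

    relAll : (Γ : TT.Ctx) → UU.Form (trCtx Γ) → UU.Form []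
    relAll []      A = A
    relAll (s ∷ Γ) A = relAll Γ (UU.∀' (sortMap s) (relHere s UU.⇒' A))

    single : ∀ {Δ s} → UU.Term Δ s → UU.Sub (s ∷ []) Δ
    single t UU.here = t

record Interpretation (T : Signature) (AxT : FOL.Form T [] → Set) (U : Theory) : Set where
  field
    dat : Interp.InterpData T (Theory.sig U)
  open Interp.InterpData dat public
  open Interp.Translate T (Theory.sig U) dat public
  field
    relInh  : (s : Signature.Sort T) →
              U ⊢ FOL.∃' {Theory.sig U} (sortMap s) (rel s)
    funRel  : (f : Signature.Fun T) →
              U ⊢ relAll (Signature.dom T f)
                    (FOL.subF (Theory.sig U) (single (funTr f)) (rel (Signature.cod T f)))
    axTr    : (A : FOL.Form T []) → AxT A → U ⊢ trF A

-- Constructors are Fin (2 + M): constructor 0 is the constant 0,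
-- constructor 1 is the unary s, and constructor (2 + i) has arity ar i.
record TreeLang : Set where
  field
    M  : ℕ
    ar : Fin M → ℕ

module Trees (L : TreeLang) where
  open TreeLang L

  Con : Set
  Con = Fin (suc (suc M))

  arity : Con → ℕ
  arity zero          = 0
  arity (suc zero)    = 1
  arity (suc (suc i)) = ar i

  data Tree : Set where
    node : (i : Con) → Vec Tree (arity i) → Tree

  zeroT : Tree
  zeroT = node zero []

  sucT : Tree → Tree
  sucT t = node (suc zero) (t ∷ [])

  oneT : Tree
  oneT = sucT zeroT

  data PR : ℕ → Set where
    cons : (i : Con) → PR (arity i)
    proj : ∀ {n} → Fin n → PR n
    comp : ∀ {m n} → PR m → Vec (PR n) m → PR n
    -- f (c_i z⃗) y⃗ = g_i (z⃗, f z₁ y⃗, …, f z_k y⃗, y⃗)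
    rec  : ∀ {n} → ((i : Con) → PR (arity i + (arity i + n))) → PR (suc n)

  mutual
    eval : ∀ {n} → PR n → Vec Tree n → Tree
    eval (cons i)    xs       = node i xs
    eval (proj j)    xs       = lookup xs j
    eval (comp g hs) xs       = eval g (evalAll hs xs)
    eval (rec gs)    (x ∷ ys) = evalRec gs ys x

    evalAll : ∀ {m n} → Vec (PR n) m → Vec Tree n → Vec Tree m
    evalAll []       xs = []
    evalAll (h ∷ hs) xs = eval h xs ∷ evalAll hs xs

    evalRec : ∀ {n} → ((i : Con) → PR (arity i + (arity i + n))) →
              Vec Tree n → Tree → Tree
    evalRec gs ys (node i zs) = eval (gs i) (zs ++ᵛ (recAll gs ys zs ++ᵛ ys))

    recAll : ∀ {n k} → ((i : Con) → PR (arity i + (arity i + n))) →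
             Vec Tree n → Vec Tree k → Vec Tree k
    recAll gs ys []       = []
    recAll gs ys (z ∷ zs) = evalRec gs ys z ∷ recAll gs ys zs

  -- S: one sort; function symbols = constructors + PR definitions;
  -- one binary predicate symbol (equality).
  SFun : Set
  SFun = Con ⊎ Σ ℕ PR

  farity : SFun → ℕ
  farity (inj₁ i)       = arity i
  farity (inj₂ (n , f)) = n

  SSig : Signature
  SSig = record
    { Sort = ⊤
    ; Fun  = SFun
    ; dom  = λ g → replicate (farity g) tt
    ; cod  = λ _ → tt
    ; Pred = ⊤
    ; pdom = λ _ → tt ∷ tt ∷ []
    }

  open FOL SSig

  Rep : ℕ → Ctx
  Rep n = replicate n tt

  Tm : Ctx → Set
  Tm Γ = Term Γ tt

  infix 7 _≐_
  _≐_ : ∀ {Γ} → Tm Γ → Tm Γ → Form Γ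
  a ≐ b = atom tt (a ∷ b ∷ [])

  vecTms : ∀ {Γ n} → Vec (Tm Γ) n → Terms Γ (Rep n)
  vecTms []       = []
  vecTms (t ∷ ts) = t ∷ vecTms ts

  gapp : ∀ {Γ} (g : SFun) → Vec (Tm Γ) (farity g) → Tm Γ
  gapp g ts = app g (vecTms ts)

  capp : ∀ {Γ} (i : Con) → Vec (Tm Γ) (arity i) → Tm Γ
  capp i = gapp (inj₁ i)

  fapp : ∀ {Γ n} → PR n → Vec (Tm Γ) n → Tm Γ
  fapp {n = n} f = gapp (inj₂ (n , f))

  mutual
    code : ∀ {Γ} → Tree → Tm Γ
    code (node i ts) = capp i (codes ts)

    codes : ∀ {Γ n} → Vec Tree n → Vec (Tm Γ) n
    codes []       = []
    codes (t ∷ ts) = code t ∷ codes ts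

  rvars : (n : ℕ) → Vec (Var (Rep n) tt) n
  rvars zero    = []
  rvars (suc n) = here ∷ mapᵛ there (rvars n)

  vars : (n : ℕ) → Vec (Tm (Rep n)) n
  vars n = mapᵛ var (rvars n)

  v : ∀ {n} → Fin n → Tm (Rep n)
  v {n} i = lookup (vars n) i

  varsL : ∀ {Γ} (k : ℕ) → Vec (Tm (Rep k ++ Γ)) k
  varsL k = mapᵛ (λ x → var (injL x)) (rvars k)

  varsR : (k n : ℕ) → Vec (Tm (Rep k ++ Rep n)) n
  varsR k n = mapᵛ (λ x → var (injR (Rep k) x)) (rvars n)

  ⋀ : ∀ {Γ} → List (Form Γ) → Form Γ
  ⋀ []       = ⊤'
  ⋀ (A ∷ As) = A ∧' ⋀ As

  eqs : ∀ {Γ n} → Vec (Tm Γ) n → Vec (Tm Γ) n → Form Γ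
  eqs []       []       = ⊤'
  eqs (x ∷ xs) (y ∷ ys) = x ≐ y ∧' eqs xs ys

  indSub : ∀ {m} (i : Con) → Sub (tt ∷ Rep m) (Rep (arity i) ++ Rep m)
  indSub i here      = capp i (varsL (arity i))
  indSub i (there x) = var (injR (Rep (arity i)) x)

  indPrem : ∀ {m} → Form (tt ∷ Rep m) → Con → Form (Rep m)
  indPrem A i = ∀* (Rep (arity i)) (subF (indSub i) A)

  data AxS : Form [] → Set where
    eq-refl  : AxS (closeAll (Rep 1) (v zero ≐ v zero))
    eq-sym   : AxS (closeAll (Rep 2) (v zero ≐ v (suc zero) ⇒' v (suc zero) ≐ v zero))
    eq-trans : AxS (closeAll (Rep 3)
                 (v zero ≐ v (suc zero) ⇒' v (suc zero) ≐ v (suc (suc zero)) ⇒'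
                  v zero ≐ v (suc (suc zero))))
    eq-cong  : (g : SFun) →
               AxS (closeAll (Rep (farity g) ++ Rep (farity g))
                 (eqs (varsL (farity g)) (varsR (farity g) (farity g)) ⇒'
                  gapp g (varsL (farity g)) ≐ gapp g (varsR (farity g) (farity g))))
    inj      : (i : Con) →
               AxS (closeAll (Rep (arity i) ++ Rep (arity i))
                 (capp i (varsL (arity i)) ≐ capp i (varsR (arity i) (arity i)) ⇒'
                  eqs (varsL (arity i)) (varsR (arity i) (arity i))))
    noconf   : (i j : Con) → i ≢ j →
               AxS (closeAll (Rep (arity i) ++ Rep (arity j))
                 (capp i (varsL (arity i)) ≐ capp j (varsR (arity i) (arity j)) ⇒' ⊥'))
    def-cons : (i : Con) →
               AxS (closeAll (Rep (arity i))
                 (fapp (cons i) (vars (arity i)) ≐ capp i (vars (arity i))))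
    def-proj : (n : ℕ) (j : Fin n) →
               AxS (closeAll (Rep n) (fapp (proj j) (vars n) ≐ v j))
    def-comp : ∀ {m n} (g : PR m) (hs : Vec (PR n) m) →
               AxS (closeAll (Rep n)
                 (fapp (comp g hs) (vars n) ≐
                  fapp g (mapᵛ (λ h → fapp h (vars n)) hs)))
    def-rec  : ∀ {n} (gs : (i : Con) → PR (arity i + (arity i + n))) (i : Con) →
               AxS (closeAll (Rep (arity i) ++ Rep n)
                 (fapp (rec gs) (capp i (varsL (arity i)) ∷ varsR (arity i) n) ≐
                  fapp (gs i) (varsL (arity i) ++ᵛ
                    (mapᵛ (λ z → fapp (rec gs) (z ∷ varsR (arity i) n)) (varsL (arity i))
                     ++ᵛ varsR (arity i) n))))
    ind      : (m : ℕ) (A : Form (tt ∷ Rep m)) →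
               AxS (closeAll (Rep m)
                 (⋀ (map (indPrem A) (allFin (suc (suc M)))) ⇒' ∀' tt A))

  -- R(t⃗) for the relation R whose characteristic function is f
  IsCharacteristic : ∀ {n} → PR n → Set
  IsCharacteristic {n} f = (ts : Vec Tree n) → (eval f ts ≡ zeroT) ⊎ (eval f ts ≡ oneT)

  RForm : ∀ {n} → PR n → Form (Rep n)
  RForm {n} f = fapp f (vars n) ≐ code oneT

  module Coded {U : Theory} (I : Interpretation SSig AxS U) where
    open Interpretation I

    codeRApp : ∀ {n} → PR n → Vec Tree n → FOL.Form (Theory.sig U) []
    codeRApp f ts = FOL.subF (Theory.sig U) (FOL.tmsSub (Theory.sig U) (trTs (vecTms (codes ts))))
                      (trF (RForm f))

    codeEq : Tree → Tree → FOL.Form (Theory.sig U) []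
    codeEq t₁ t₂ = trF (code t₁ ≐ code t₂)

module Submission where

-- Instantiating the translated axioms of S at codes makes provable equality in U a
-- congruence that satisfies the defining equations, so by induction on the primitive
-- recursive definition U ⊢ ⌜f(t⃗) = v⌝, where v is the value of f at t⃗.  Conversely, if
-- U ⊢ ⌜t₁ = t₂⌝ and t₁ ≠ t₂, injectivity strips common outermost constructors until two
-- distinct ones meet and non-confusion proves ⊥; a consistent U thus proves only true
-- equations between codes.  As a characteristic function takes only the values 0 and 1,
-- U ⊢ ⌜f(t⃗) = 1⌝ at a point of value 0 would give U ⊢ ⌜0 = 1⌝.

open import Data.Fin using (Fin; zero; suc)
open import Data.Fin.Properties using (_≟_)
open import Data.List using ([]; _∷_; _++_)
open import Data.Nat using (ℕ; zero; suc; _+_)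
open import Data.Product using (_×_; _,_)
open import Data.Sum using (inj₁; inj₂)
open import Data.Vec using (Vec; []; _∷_; lookup) renaming (_++_ to _++ᵛ_; map to mapᵛ)
open import Data.Vec.Properties using (map-∘; map-cong; map-++; lookup-map)
open import Function.Bundles using (_⇔_; mk⇔)
open import Relation.Binary.PropositionalEquality
open import Relation.Nullary using (yes; no; contradiction)

open import Defs

module SubstitutionLaws (Sg : Signature) where
  open FOL Sg

  infix 4 _≗ₛ_
  _≗ₛ_ : ∀ {Γ Δ} → Sub Γ Δ → Sub Γ Δ → Set
  σ ≗ₛ τ = ∀ {s} (x : Var _ s) → σ x ≡ τ x

  mutual
    subT-cong : ∀ {Γ Δ s} {σ τ : Sub Γ Δ} → σ ≗ₛ τ → (t : Term Γ s) → subT σ t ≡ subT τ t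
    subT-cong e (var x)    = e x
    subT-cong e (app f ts) = cong (app f) (subTs-cong e ts)

    subTs-cong : ∀ {Γ Δ ss} {σ τ : Sub Γ Δ} → σ ≗ₛ τ → (ts : Terms Γ ss) → subTs σ ts ≡ subTs τ ts
    subTs-cong e []       = refl
    subTs-cong e (t ∷ ts) = cong₂ _∷_ (subT-cong e t) (subTs-cong e ts)

  liftS-cong : ∀ {Γ Δ s} {σ τ : Sub Γ Δ} → σ ≗ₛ τ → liftS {s = s} σ ≗ₛ liftS τ
  liftS-cong e here      = refl
  liftS-cong e (there x) = cong (renT there) (e x)

  subF-cong : ∀ {Γ Δ} {σ τ : Sub Γ Δ} → σ ≗ₛ τ → (A : Form Γ) → subF σ A ≡ subF τ A
  subF-cong e (atom p ts) = cong (atom p) (subTs-cong e ts)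
  subF-cong e ⊥'          = refl
  subF-cong e ⊤'          = refl
  subF-cong e (A ∧' B)    = cong₂ _∧'_ (subF-cong e A) (subF-cong e B)
  subF-cong e (A ∨' B)    = cong₂ _∨'_ (subF-cong e A) (subF-cong e B)
  subF-cong e (A ⇒' B)    = cong₂ _⇒'_ (subF-cong e A) (subF-cong e B)
  subF-cong e (∀' s A)    = cong (∀' s) (subF-cong (liftS-cong e) A)
  subF-cong e (∃' s A)    = cong (∃' s) (subF-cong (liftS-cong e) A)

  mutual
    subT-id : ∀ {Γ s} (t : Term Γ s) → subT var t ≡ t
    subT-id (var x)    = refl
    subT-id (app f ts) = cong (app f) (subTs-id ts)

    subTs-id : ∀ {Γ ss} (ts : Terms Γ ss) → subTs var ts ≡ ts
    subTs-id []       = refl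
    subTs-id (t ∷ ts) = cong₂ _∷_ (subT-id t) (subTs-id ts)

  liftS-id : ∀ {Γ s} → liftS {Γ = Γ} {s = s} var ≗ₛ var
  liftS-id here      = refl
  liftS-id (there x) = refl

  subF-id : ∀ {Γ} (A : Form Γ) → subF var A ≡ A
  subF-id (atom p ts) = cong (atom p) (subTs-id ts)
  subF-id ⊥'          = refl
  subF-id ⊤'          = refl
  subF-id (A ∧' B)    = cong₂ _∧'_ (subF-id A) (subF-id B)
  subF-id (A ∨' B)    = cong₂ _∨'_ (subF-id A) (subF-id B)
  subF-id (A ⇒' B)    = cong₂ _⇒'_ (subF-id A) (subF-id B)
  subF-id (∀' s A)    = cong (∀' s) (trans (subF-cong liftS-id A) (subF-id A))
  subF-id (∃' s A)    = cong (∃' s) (trans (subF-cong liftS-id A) (subF-id A))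

  mutual
    subT-renT : ∀ {Γ Δ Θ s} (σ : Sub Δ Θ) (ρ : Ren Γ Δ) (t : Term Γ s) →
                subT σ (renT ρ t) ≡ subT (λ x → σ (ρ x)) t
    subT-renT σ ρ (var x)    = refl
    subT-renT σ ρ (app f ts) = cong (app f) (subTs-renTs σ ρ ts)

    subTs-renTs : ∀ {Γ Δ Θ ss} (σ : Sub Δ Θ) (ρ : Ren Γ Δ) (ts : Terms Γ ss) →
                  subTs σ (renTs ρ ts) ≡ subTs (λ x → σ (ρ x)) ts
    subTs-renTs σ ρ []       = refl
    subTs-renTs σ ρ (t ∷ ts) = cong₂ _∷_ (subT-renT σ ρ t) (subTs-renTs σ ρ ts)

  mutual
    renT-subT : ∀ {Γ Δ Θ s} (ρ : Ren Δ Θ) (σ : Sub Γ Δ) (t : Term Γ s) →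
                renT ρ (subT σ t) ≡ subT (λ x → renT ρ (σ x)) t
    renT-subT ρ σ (var x)    = refl
    renT-subT ρ σ (app f ts) = cong (app f) (renTs-subTs ρ σ ts)

    renTs-subTs : ∀ {Γ Δ Θ ss} (ρ : Ren Δ Θ) (σ : Sub Γ Δ) (ts : Terms Γ ss) →
                  renTs ρ (subTs σ ts) ≡ subTs (λ x → renT ρ (σ x)) ts
    renTs-subTs ρ σ []       = refl
    renTs-subTs ρ σ (t ∷ ts) = cong₂ _∷_ (renT-subT ρ σ t) (renTs-subTs ρ σ ts)

  mutual
    subT-subT : ∀ {Γ Δ Θ s} (σ : Sub Δ Θ) (τ : Sub Γ Δ) (t : Term Γ s) →
                subT σ (subT τ t) ≡ subT (λ x → subT σ (τ x)) t
    subT-subT σ τ (var x)    = refl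
    subT-subT σ τ (app f ts) = cong (app f) (subTs-subTs σ τ ts)

    subTs-subTs : ∀ {Γ Δ Θ ss} (σ : Sub Δ Θ) (τ : Sub Γ Δ) (ts : Terms Γ ss) →
                  subTs σ (subTs τ ts) ≡ subTs (λ x → subT σ (τ x)) ts
    subTs-subTs σ τ []       = refl
    subTs-subTs σ τ (t ∷ ts) = cong₂ _∷_ (subT-subT σ τ t) (subTs-subTs σ τ ts)

  liftS-subT : ∀ {Γ Δ Θ s} (σ : Sub Δ Θ) (τ : Sub Γ Δ) →
               (λ {s'} (x : Var (s ∷ Γ) s') → subT (liftS σ) (liftS τ x)) ≗ₛ liftS (λ x → subT σ (τ x))
  liftS-subT σ τ here      = refl
  liftS-subT σ τ (there x) = trans (subT-renT (liftS σ) there (τ x)) (sym (renT-subT there σ (τ x)))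

  subF-subF : ∀ {Γ Δ Θ} (σ : Sub Δ Θ) (τ : Sub Γ Δ) (A : Form Γ) →
              subF σ (subF τ A) ≡ subF (λ x → subT σ (τ x)) A
  subF-subF σ τ (atom p ts) = cong (atom p) (subTs-subTs σ τ ts)
  subF-subF σ τ ⊥'          = refl
  subF-subF σ τ ⊤'          = refl
  subF-subF σ τ (A ∧' B)    = cong₂ _∧'_ (subF-subF σ τ A) (subF-subF σ τ B)
  subF-subF σ τ (A ∨' B)    = cong₂ _∨'_ (subF-subF σ τ A) (subF-subF σ τ B)
  subF-subF σ τ (A ⇒' B)    = cong₂ _⇒'_ (subF-subF σ τ A) (subF-subF σ τ B)
  subF-subF σ τ (∀' s A)    =
    cong (∀' s) (trans (subF-subF (liftS σ) (liftS τ) A) (subF-cong (liftS-subT σ τ) A))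
  subF-subF σ τ (∃' s A)    =
    cong (∃' s) (trans (subF-subF (liftS σ) (liftS τ) A) (subF-cong (liftS-subT σ τ) A))

  liftS-liftR : ∀ {Γ Δ Θ s} (σ : Sub Δ Θ) (ρ : Ren Γ Δ) →
                (λ {s'} (x : Var (s ∷ Γ) s') → liftS σ (liftR ρ x)) ≗ₛ liftS (λ x → σ (ρ x))
  liftS-liftR σ ρ here      = refl
  liftS-liftR σ ρ (there x) = refl

  subF-renF : ∀ {Γ Δ Θ} (σ : Sub Δ Θ) (ρ : Ren Γ Δ) (A : Form Γ) →
              subF σ (renF ρ A) ≡ subF (λ x → σ (ρ x)) A
  subF-renF σ ρ (atom p ts) = cong (atom p) (subTs-renTs σ ρ ts)
  subF-renF σ ρ ⊥'          = refl
  subF-renF σ ρ ⊤'          = refl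
  subF-renF σ ρ (A ∧' B)    = cong₂ _∧'_ (subF-renF σ ρ A) (subF-renF σ ρ B)
  subF-renF σ ρ (A ∨' B)    = cong₂ _∨'_ (subF-renF σ ρ A) (subF-renF σ ρ B)
  subF-renF σ ρ (A ⇒' B)    = cong₂ _⇒'_ (subF-renF σ ρ A) (subF-renF σ ρ B)
  subF-renF σ ρ (∀' s A)    =
    cong (∀' s) (trans (subF-renF (liftS σ) (liftR ρ) A) (subF-cong (liftS-liftR σ ρ) A))
  subF-renF σ ρ (∃' s A)    =
    cong (∃' s) (trans (subF-renF (liftS σ) (liftR ρ) A) (subF-cong (liftS-liftR σ ρ) A))

  tmsSub-subTs : ∀ {Γ Δ ss} (σ : Sub Γ Δ) (us : Terms Γ ss) →
                 tmsSub (subTs σ us) ≗ₛ (λ x → subT σ (tmsSub us x))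
  tmsSub-subTs σ (u ∷ us) here      = refl
  tmsSub-subTs σ (u ∷ us) (there x) = tmsSub-subTs σ us x

  subT-σ₀-wk : ∀ {Γ s s'} (t : Term Γ s) (u : Term Γ s') → subT (σ₀ t) (renT there u) ≡ u
  subT-σ₀-wk t u = trans (subT-renT (σ₀ t) there u) (subT-id u)

module AxiomInstances {T : Signature} {AxT : FOL.Form T [] → Set} {U : Theory}
                      (I : Interpretation T AxT U) where
  open FOL T
  module UU = FOL (Theory.sig U)
  module UL = SubstitutionLaws (Theory.sig U)
  open Interpretation I
  open FOL.Proofs (Theory.sig U) (Theory.logic U) (Theory.Ax U) using (∀E; ⇒E)

  trSub : ∀ {Γ Δ} → Sub Γ Δ → UU.Sub (trCtx Γ) (trCtx Δ)
  trSub {s ∷ Γ} σ UU.here      = trT (σ here)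
  trSub {s ∷ Γ} σ (UU.there w) = trSub (λ x → σ (there x)) w

  trSub-trVar : ∀ {Γ Δ s} (σ : Sub Γ Δ) (x : Var Γ s) → trSub σ (trVar x) ≡ trT (σ x)
  trSub-trVar σ here      = refl
  trSub-trVar σ (there x) = trSub-trVar (λ y → σ (there y)) x

  trSub-tmsSub : ∀ {ss} (ts : Terms [] ss) → trSub (tmsSub ts) UL.≗ₛ UU.tmsSub (trTs ts)
  trSub-tmsSub (t ∷ ts) UU.here      = refl
  trSub-tmsSub (t ∷ ts) (UU.there w) = trSub-tmsSub ts w

  mutual
    trT-subT : ∀ {Γ Δ s} (σ : Sub Γ Δ) (a : Term Γ s) → trT (subT σ a) ≡ UU.subT (trSub σ) (trT a)
    trT-subT σ (var x)    = sym (trSub-trVar σ x)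
    trT-subT σ (app f ts) = trans (UL.subT-cong (tmsSub-trTs-subTs σ ts) (funTr f))
                                  (sym (UL.subT-subT (trSub σ) (UU.tmsSub (trTs ts)) (funTr f)))

    trTs-subTs : ∀ {Γ Δ ss} (σ : Sub Γ Δ) (ts : Terms Γ ss) → trTs (subTs σ ts) ≡ UU.subTs (trSub σ) (trTs ts)
    trTs-subTs σ []       = refl
    trTs-subTs σ (t ∷ ts) = cong₂ UU._∷_ (trT-subT σ t) (trTs-subTs σ ts)

    tmsSub-trTs-subTs : ∀ {Γ Δ ss} (σ : Sub Γ Δ) (ts : Terms Γ ss) →
                        UU.tmsSub (trTs (subTs σ ts)) UL.≗ₛ (λ x → UU.subT (trSub σ) (UU.tmsSub (trTs ts) x))
    tmsSub-trTs-subTs σ ts w = trans (cong (λ us → UU.tmsSub us w) (trTs-subTs σ ts))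
                                     (UL.tmsSub-subTs (trSub σ) (trTs ts) w)

  data QF {Γ} : Form Γ → Set where
    qf-atom : ∀ {p ts} → QF (atom p ts)
    qf-⊥    : QF ⊥'
    qf-⊤    : QF ⊤'
    qf-∧    : ∀ {A B} → QF A → QF B → QF (A ∧' B)
    qf-∨    : ∀ {A B} → QF A → QF B → QF (A ∨' B)
    qf-⇒    : ∀ {A B} → QF A → QF B → QF (A ⇒' B)

  -- Restricted to open formulas: these are all the axiom bodies that get instantiated,
  -- and it spares commuting relativization predicates with lifted substitutions.
  trF-subF : ∀ {Γ Δ} (σ : Sub Γ Δ) {A : Form Γ} → QF A → UU.subF (trSub σ) (trF A) ≡ trF (subF σ A)
  trF-subF σ (qf-atom {p} {ts}) =
    trans (UL.subF-subF (trSub σ) (UU.tmsSub (trTs ts)) (predTr p))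
          (UL.subF-cong (λ w → sym (tmsSub-trTs-subTs σ ts w)) (predTr p))
  trF-subF σ qf-⊥        = refl
  trF-subF σ qf-⊤        = refl
  trF-subF σ (qf-∧ a b)  = cong₂ UU._∧'_ (trF-subF σ a) (trF-subF σ b)
  trF-subF σ (qf-∨ a b)  = cong₂ UU._∨'_ (trF-subF σ a) (trF-subF σ b)
  trF-subF σ (qf-⇒ a b)  = cong₂ UU._⇒'_ (trF-subF σ a) (trF-subF σ b)

  trF-closeAll : (Γ : Ctx) (A : Form Γ) → trF (closeAll Γ A) ≡ relAll Γ (trF A)
  trF-closeAll []      A = refl
  trF-closeAll (s ∷ Γ) A = trF-closeAll Γ (∀' s A)

  Relativized : ∀ {s} → Term [] s → Set
  Relativized {s} t = U ⊢ UU.subF (single (trT t)) (rel s)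

  relAll-instance : (Γ : Ctx) (B : UU.Form (trCtx Γ)) (σ : Sub Γ []) →
                    (∀ {s} (x : Var Γ s) → Relativized (σ x)) →
                    U ⊢ relAll Γ B → U ⊢ UU.subF (trSub σ) B
  relAll-instance [] B σ r d =
    subst (U ⊢_) (sym (trans (UL.subF-cong (λ ()) B) (UL.subF-id B))) d
  relAll-instance (s ∷ Γ) B σ r d =
    ⇒E (subst (U ⊢_) (cong₂ UU._⇒'_ rel-instance body-instance) (∀E outer t)) (r here)
    where
      τ = trSub (λ x → σ (there x))
      t = trT (σ here)

      outer : U ⊢ UU.∀' (sortMap s) (UU.subF (UU.liftS τ) (relHere s) UU.⇒' UU.subF (UU.liftS τ) B)
      outer = relAll-instance Γ _ (λ x → σ (there x)) (λ x → r (there x)) d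

      σ₀-liftS : (λ {s'} (x : UU.Var (trCtx (s ∷ Γ)) s') → UU.subT (UU.σ₀ t) (UU.liftS τ x)) UL.≗ₛ trSub σ
      σ₀-liftS UU.here      = refl
      σ₀-liftS (UU.there w) = UL.subT-σ₀-wk t (τ w)

      body-instance : UU.subF (UU.σ₀ t) (UU.subF (UU.liftS τ) B) ≡ UU.subF (trSub σ) B
      body-instance = trans (UL.subF-subF (UU.σ₀ t) (UU.liftS τ) B) (UL.subF-cong σ₀-liftS B)

      rel-instance : UU.subF (UU.σ₀ t) (UU.subF (UU.liftS τ) (relHere s)) ≡ UU.subF (single t) (rel s)
      rel-instance = begin
        UU.subF (UU.σ₀ t) (UU.subF (UU.liftS τ) (relHere s))
          ≡⟨ UL.subF-subF (UU.σ₀ t) (UU.liftS τ) (relHere s) ⟩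
        UU.subF (λ x → UU.subT (UU.σ₀ t) (UU.liftS τ x)) (UU.renF ren0 (rel s))
          ≡⟨ UL.subF-renF _ ren0 (rel s) ⟩
        UU.subF (λ x → UU.subT (UU.σ₀ t) (UU.liftS τ (ren0 x))) (rel s)
          ≡⟨ UL.subF-cong (λ { UU.here → refl }) (rel s) ⟩
        UU.subF (single t) (rel s)
          ∎
        where open ≡-Reasoning

  mutual
    trT-relativized : ∀ {s} (t : Term [] s) → Relativized t
    trT-relativized (app f ts) =
      subst (U ⊢_) translated-rel
            (relAll-instance (Signature.dom T f) _ (tmsSub ts) (trTs-relativized ts) (funRel f))
      where
        translated-rel : UU.subF (trSub (tmsSub ts)) (UU.subF (single (funTr f)) (rel (Signature.cod T f))) ≡
                         UU.subF (single (trT (app f ts))) (rel (Signature.cod T f))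
        translated-rel = trans (UL.subF-subF (trSub (tmsSub ts)) (single (funTr f)) _)
          (UL.subF-cong (λ { UU.here → UL.subT-cong (trSub-tmsSub ts) (funTr f) }) _)

    trTs-relativized : ∀ {ss} (ts : Terms [] ss) {s} (x : Var ss s) → Relativized (tmsSub ts x)
    trTs-relativized (t ∷ ts) here      = trT-relativized t
    trTs-relativized (t ∷ ts) (there x) = trTs-relativized ts x

  axiom-instance : ∀ {Γ} {A : Form Γ} → QF A → AxT (closeAll Γ A) → (σ : Sub Γ []) → U ⊢ trF (subF σ A)
  axiom-instance {Γ} {A} qf ax σ =
    subst (U ⊢_) (trF-subF σ qf)
      (relAll-instance Γ (trF A) σ (λ x → trT-relativized (σ x))
        (subst (U ⊢_) (trF-closeAll Γ A) (axTr _ ax)))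

module TreeTerms (L : TreeLang) where
  open Trees L
  open FOL SSig

  vecSub : ∀ {Δ n} → Vec (Tm Δ) n → Sub (Rep n) Δ
  vecSub ws = tmsSub (vecTms ws)

  appendSub : ∀ {Γ Δ} k → Sub (Rep k) Δ → Sub Γ Δ → Sub (Rep k ++ Γ) Δ
  appendSub zero    σ τ x         = τ x
  appendSub (suc k) σ τ here      = σ here
  appendSub (suc k) σ τ (there x) = appendSub k (λ y → σ (there y)) τ x

  pairSub : ∀ {Δ k n} → Vec (Tm Δ) k → Vec (Tm Δ) n → Sub (Rep k ++ Rep n) Δ
  pairSub {k = k} xs ys = appendSub k (vecSub xs) (vecSub ys)

  appendSub-injL : ∀ {Γ Δ} k (σ : Sub (Rep k) Δ) (τ : Sub Γ Δ) {s} (x : Var (Rep k) s) →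
                   appendSub k σ τ (injL x) ≡ σ x
  appendSub-injL (suc k) σ τ here      = refl
  appendSub-injL (suc k) σ τ (there x) = appendSub-injL k (λ y → σ (there y)) τ x

  appendSub-injR : ∀ {Γ Δ} k (σ : Sub (Rep k) Δ) (τ : Sub Γ Δ) {s} (x : Var Γ s) →
                   appendSub k σ τ (injR (Rep k) x) ≡ τ x
  appendSub-injR zero    σ τ x = refl
  appendSub-injR (suc k) σ τ x = appendSub-injR k (λ y → σ (there y)) τ x

  vecTms-subTs : ∀ {Γ Δ n} (σ : Sub Γ Δ) (xs : Vec (Tm Γ) n) →
                 subTs σ (vecTms xs) ≡ vecTms (mapᵛ (subT σ) xs)
  vecTms-subTs σ []       = refl
  vecTms-subTs σ (x ∷ xs) = cong (subT σ x ∷_) (vecTms-subTs σ xs)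

  gapp-subT : ∀ {Γ Δ} (σ : Sub Γ Δ) (g : SFun) (xs : Vec (Tm Γ) (farity g)) →
              subT σ (gapp g xs) ≡ gapp g (mapᵛ (subT σ) xs)
  gapp-subT σ g xs = cong (app g) (vecTms-subTs σ xs)

  eqs-subF : ∀ {Γ Δ n} (σ : Sub Γ Δ) (xs ys : Vec (Tm Γ) n) →
             subF σ (eqs xs ys) ≡ eqs (mapᵛ (subT σ) xs) (mapᵛ (subT σ) ys)
  eqs-subF σ []       []       = refl
  eqs-subF σ (x ∷ xs) (y ∷ ys) = cong (subT σ x ≐ subT σ y ∧'_) (eqs-subF σ xs ys)

  rvars-vecSub : ∀ {Δ n} (ws : Vec (Tm Δ) n) → mapᵛ (vecSub ws) (rvars n) ≡ ws
  rvars-vecSub []       = refl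
  rvars-vecSub (w ∷ ws) =
    cong (w ∷_) (trans (sym (map-∘ (vecSub (w ∷ ws)) there _)) (rvars-vecSub ws))

  vars-vecSub : ∀ {Δ n} (ws : Vec (Tm Δ) n) → mapᵛ (subT (vecSub ws)) (vars n) ≡ ws
  vars-vecSub {n = n} ws = trans (sym (map-∘ (subT (vecSub ws)) var (rvars n))) (rvars-vecSub ws)

  varsL-pairSub : ∀ {Δ k n} (xs : Vec (Tm Δ) k) (ys : Vec (Tm Δ) n) →
                  mapᵛ (subT (pairSub xs ys)) (varsL k) ≡ xs
  varsL-pairSub {k = k} xs ys =
    trans (sym (map-∘ (subT (pairSub xs ys)) (λ x → var (injL x)) (rvars k)))
          (trans (map-cong (appendSub-injL k (vecSub xs) (vecSub ys)) (rvars k)) (rvars-vecSub xs))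

  varsR-pairSub : ∀ {Δ k n} (xs : Vec (Tm Δ) k) (ys : Vec (Tm Δ) n) →
                  mapᵛ (subT (pairSub xs ys)) (varsR k n) ≡ ys
  varsR-pairSub {k = k} {n} xs ys =
    trans (sym (map-∘ (subT (pairSub xs ys)) (λ x → var (injR (Rep k) x)) (rvars n)))
          (trans (map-cong (appendSub-injR k (vecSub xs) (vecSub ys)) (rvars n)) (rvars-vecSub ys))

  gapp-vars-vecSub : ∀ {Δ} (g : SFun) (ws : Vec (Tm Δ) (farity g)) →
                     subT (vecSub ws) (gapp g (vars (farity g))) ≡ gapp g ws
  gapp-vars-vecSub g ws = trans (gapp-subT (vecSub ws) g _) (cong (gapp g) (vars-vecSub ws))

  gapp-varsL-pairSub : ∀ {Δ n} (g : SFun) (xs : Vec (Tm Δ) (farity g)) (ys : Vec (Tm Δ) n) →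
                       subT (pairSub xs ys) (gapp g (varsL (farity g))) ≡ gapp g xs
  gapp-varsL-pairSub g xs ys = trans (gapp-subT (pairSub xs ys) g _) (cong (gapp g) (varsL-pairSub xs ys))

  gapp-varsR-pairSub : ∀ {Δ k} (g : SFun) (xs : Vec (Tm Δ) k) (ys : Vec (Tm Δ) (farity g)) →
                       subT (pairSub xs ys) (gapp g (varsR k (farity g))) ≡ gapp g ys
  gapp-varsR-pairSub g xs ys = trans (gapp-subT (pairSub xs ys) g _) (cong (gapp g) (varsR-pairSub xs ys))

  eqs-pairSub : ∀ {Δ k} (xs ys : Vec (Tm Δ) k) →
                subF (pairSub xs ys) (eqs (varsL k) (varsR k k)) ≡ eqs xs ys
  eqs-pairSub {k = k} xs ys = trans (eqs-subF (pairSub xs ys) (varsL k) (varsR k k))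
                                    (cong₂ eqs (varsL-pairSub xs ys) (varsR-pairSub xs ys))

  codes-++ : ∀ {Γ m n} (xs : Vec Tree m) (ys : Vec Tree n) →
             codes {Γ} (xs ++ᵛ ys) ≡ codes xs ++ᵛ codes ys
  codes-++ []       ys = refl
  codes-++ (x ∷ xs) ys = cong (code x ∷_) (codes-++ xs ys)

  lookup-codes : ∀ {Γ n} (xs : Vec Tree n) (j : Fin n) → lookup (codes {Γ} xs) j ≡ code (lookup xs j)
  lookup-codes (x ∷ xs) zero    = refl
  lookup-codes (x ∷ xs) (suc j) = lookup-codes xs j

module Representability (L : TreeLang) (U : Theory)
                        (I : Interpretation (Trees.SSig L) (Trees.AxS L) U) where
  open Trees L
  open FOL SSig
  open TreeTerms L
  open Interpretation I using (trF; trTs)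
  open AxiomInstances I
  open FOL.Proofs (Theory.sig U) (Theory.logic U) (Theory.Ax U) using (⊤I; ∧I; ∧E₁; ∧E₂; ⇒E)

  infix 4 _≈_ _≋_

  -- Records rather than synonyms, so that the terms stay inferable: trF is not injective.
  record _≈_ (a b : Tm []) : Set where
    constructor mk≈
    field un≈ : U ⊢ trF (a ≐ b)
  open _≈_

  record _≋_ {n} (as bs : Vec (Tm []) n) : Set where
    constructor mk≋
    field un≋ : U ⊢ trF (eqs as bs)
  open _≋_

  ≐-instance : ∀ {Γ} {a b : Tm Γ} {a′ b′ : Tm []} → AxS (closeAll Γ (a ≐ b)) → (σ : Sub Γ []) →
               subT σ a ≡ a′ → subT σ b ≡ b′ → a′ ≈ b′
  ≐-instance ax σ refl refl = mk≈ (axiom-instance qf-atom ax σ)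

  ⇒-instance : ∀ {Γ} {A B : Form Γ} {A′ B′ : Form []} → QF A → QF B →
               AxS (closeAll Γ (A ⇒' B)) → (σ : Sub Γ []) →
               subF σ A ≡ A′ → subF σ B ≡ B′ → U ⊢ trF A′ → U ⊢ trF B′
  ⇒-instance qa qb ax σ refl refl = ⇒E (axiom-instance (qf-⇒ qa qb) ax σ)

  qf-eqs : ∀ {Γ n} (xs ys : Vec (Tm Γ) n) → QF (eqs xs ys)
  qf-eqs []       []       = qf-⊤
  qf-eqs (x ∷ xs) (y ∷ ys) = qf-∧ qf-atom (qf-eqs xs ys)

  ≈-refl : (a : Tm []) → a ≈ a
  ≈-refl a = ≐-instance eq-refl (vecSub (a ∷ [])) refl refl

  ≈-sym : ∀ {a b} → a ≈ b → b ≈ a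
  ≈-sym {a} {b} (mk≈ e) =
    mk≈ (⇒-instance qf-atom qf-atom eq-sym (vecSub (a ∷ b ∷ [])) refl refl e)

  ≈-trans : ∀ {a b c} → a ≈ b → b ≈ c → a ≈ c
  ≈-trans {a} {b} {c} (mk≈ e₁) (mk≈ e₂) =
    mk≈ (⇒E (⇒E (axiom-instance (qf-⇒ qf-atom (qf-⇒ qf-atom qf-atom)) eq-trans
                                (vecSub (a ∷ b ∷ c ∷ []))) e₁) e₂)

  ≋-refl : ∀ {n} (as : Vec (Tm []) n) → as ≋ as
  ≋-refl []       = mk≋ ⊤I
  ≋-refl (a ∷ as) = mk≋ (∧I (un≈ (≈-refl a)) (un≋ (≋-refl as)))

  _∷≋_ : ∀ {n a b} {as bs : Vec (Tm []) n} → a ≈ b → as ≋ bs → (a ∷ as) ≋ (b ∷ bs)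
  mk≈ e ∷≋ mk≋ es = mk≋ (∧I e es)

  ≋-++ : ∀ {m n} {as cs : Vec (Tm []) m} {bs ds : Vec (Tm []) n} →
         as ≋ cs → bs ≋ ds → (as ++ᵛ bs) ≋ (cs ++ᵛ ds)
  ≋-++ {as = []}    {[]}    _        e = e
  ≋-++ {as = _ ∷ _} {_ ∷ _} (mk≋ e₁) e = mk≈ (∧E₁ e₁) ∷≋ ≋-++ (mk≋ (∧E₂ e₁)) e

  ≈-cong : (g : SFun) {as bs : Vec (Tm []) (farity g)} → as ≋ bs → gapp g as ≈ gapp g bs
  ≈-cong g {as} {bs} (mk≋ e) =
    mk≈ (⇒-instance (qf-eqs _ _) qf-atom (eq-cong g) (pairSub as bs) (eqs-pairSub as bs)
                    (cong₂ _≐_ (gapp-varsL-pairSub g as bs) (gapp-varsR-pairSub g as bs)) e)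

  capp-injective : (i : Con) {as bs : Vec (Tm []) (arity i)} → capp i as ≈ capp i bs → as ≋ bs
  capp-injective i {as} {bs} (mk≈ e) =
    mk≋ (⇒-instance qf-atom (qf-eqs _ _) (inj i) (pairSub as bs)
                    (cong₂ _≐_ (gapp-varsL-pairSub (inj₁ i) as bs) (gapp-varsR-pairSub (inj₁ i) as bs))
                    (eqs-pairSub as bs) e)

  capp-disjoint : (i j : Con) → i ≢ j → {as : Vec (Tm []) (arity i)} {bs : Vec (Tm []) (arity j)} →
                  capp i as ≈ capp j bs → U ⊢ FOL.⊥' {Theory.sig U}
  capp-disjoint i j i≢j {as} {bs} (mk≈ e) =
    ⇒-instance qf-atom qf-⊥ (noconf i j i≢j) (pairSub as bs)
               (cong₂ _≐_ (gapp-varsL-pairSub (inj₁ i) as bs) (gapp-varsR-pairSub (inj₁ j) as bs))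
               refl e

  fapp-cons : (i : Con) (as : Vec (Tm []) (arity i)) → fapp (cons i) as ≈ capp i as
  fapp-cons i as = ≐-instance (def-cons i) (vecSub as)
                     (gapp-vars-vecSub (inj₂ (arity i , cons i)) as) (gapp-vars-vecSub (inj₁ i) as)

  fapp-proj : ∀ {n} (j : Fin n) (as : Vec (Tm []) n) → fapp (proj j) as ≈ lookup as j
  fapp-proj {n} j as = ≐-instance (def-proj n j) (vecSub as)
                         (gapp-vars-vecSub (inj₂ (n , proj j)) as)
                         (trans (sym (lookup-map j (subT (vecSub as)) (vars n)))
                                (cong (λ ws → lookup ws j) (vars-vecSub as)))

  fapp-comp : ∀ {m n} (g : PR m) (hs : Vec (PR n) m) (as : Vec (Tm []) n) →
              fapp (comp g hs) as ≈ fapp g (mapᵛ (λ h → fapp h as) hs)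
  fapp-comp {m} {n} g hs as = ≐-instance (def-comp g hs) σ
                                (gapp-vars-vecSub (inj₂ (n , comp g hs)) as) composed
    where
      σ = vecSub as
      composed : subT σ (fapp g (mapᵛ (λ h → fapp h (vars n)) hs)) ≡ fapp g (mapᵛ (λ h → fapp h as) hs)
      composed = begin
        subT σ (fapp g (mapᵛ (λ h → fapp h (vars n)) hs))        ≡⟨ gapp-subT σ (inj₂ (m , g)) _ ⟩
        fapp g (mapᵛ (subT σ) (mapᵛ (λ h → fapp h (vars n)) hs)) ≡⟨ cong (fapp g) (sym (map-∘ (subT σ) _ hs)) ⟩
        fapp g (mapᵛ (λ h → subT σ (fapp h (vars n))) hs)
          ≡⟨ cong (fapp g) (map-cong (λ h → gapp-vars-vecSub (inj₂ (n , h)) as) hs) ⟩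
        fapp g (mapᵛ (λ h → fapp h as) hs)                       ∎
        where open ≡-Reasoning

  fapp-rec : ∀ {n} (gs : (i : Con) → PR (arity i + (arity i + n))) (i : Con)
             (zs : Vec (Tm []) (arity i)) (ys : Vec (Tm []) n) →
             fapp (rec gs) (capp i zs ∷ ys) ≈
             fapp (gs i) (zs ++ᵛ (mapᵛ (λ z → fapp (rec gs) (z ∷ ys)) zs ++ᵛ ys))
  fapp-rec {n} gs i zs ys = ≐-instance (def-rec gs i) σ
    (trans (recursive-call (capp i (varsL k))) (cong (recCall ys) (gapp-varsL-pairSub (inj₁ i) zs ys)))
    (trans (gapp-subT σ (inj₂ (k + (k + n) , gs i)) _) (cong (fapp (gs i)) arguments))
    where
      k = arity i
      σ = pairSub zs ys

      recCall : ∀ {Γ} → Vec (Tm Γ) n → Tm Γ → Tm Γ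
      recCall ws z = fapp (rec gs) (z ∷ ws)

      recursive-call : (z : Tm (Rep k ++ Rep n)) → subT σ (recCall (varsR k n) z) ≡ recCall ys (subT σ z)
      recursive-call z = trans (gapp-subT σ (inj₂ (suc n , rec gs)) (z ∷ varsR k n))
                               (cong (λ ws → recCall ws (subT σ z)) (varsR-pairSub zs ys))

      recursive-calls : mapᵛ (subT σ) (mapᵛ (recCall (varsR k n)) (varsL k)) ≡ mapᵛ (recCall ys) zs
      recursive-calls = begin
        mapᵛ (subT σ) (mapᵛ (recCall (varsR k n)) (varsL k))  ≡⟨ sym (map-∘ (subT σ) (recCall (varsR k n)) (varsL k)) ⟩
        mapᵛ (λ z → subT σ (recCall (varsR k n) z)) (varsL k) ≡⟨ map-cong recursive-call (varsL k) ⟩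
        mapᵛ (λ z → recCall ys (subT σ z)) (varsL k)          ≡⟨ map-∘ (recCall ys) (subT σ) (varsL k) ⟩
        mapᵛ (recCall ys) (mapᵛ (subT σ) (varsL k))           ≡⟨ cong (mapᵛ (recCall ys)) (varsL-pairSub zs ys) ⟩
        mapᵛ (recCall ys) zs                                  ∎
        where open ≡-Reasoning

      arguments : mapᵛ (subT σ) (varsL k ++ᵛ (mapᵛ (recCall (varsR k n)) (varsL k) ++ᵛ varsR k n)) ≡
                  zs ++ᵛ (mapᵛ (recCall ys) zs ++ᵛ ys)
      arguments = trans (map-++ (subT σ) (varsL k) _)
        (cong₂ _++ᵛ_ (varsL-pairSub zs ys)
                     (trans (map-++ (subT σ) _ (varsR k n)) (cong₂ _++ᵛ_ recursive-calls (varsR-pairSub zs ys))))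

  mutual
    eval-≈ : ∀ {n} (f : PR n) (xs : Vec Tree n) → fapp f (codes xs) ≈ code (eval f xs)
    eval-≈ (cons i)          xs       = fapp-cons i (codes xs)
    eval-≈ (proj j)          xs       = subst (fapp (proj j) (codes xs) ≈_) (lookup-codes xs j)
                                              (fapp-proj j (codes xs))
    eval-≈ (comp {m} g hs)   xs       = ≈-trans (fapp-comp g hs (codes xs))
                                          (≈-trans (≈-cong (inj₂ (m , g)) (evalAll-≋ hs xs))
                                                   (eval-≈ g (evalAll hs xs)))
    eval-≈ (rec gs)          (x ∷ ys) = evalRec-≈ gs ys x

    evalAll-≋ : ∀ {m n} (hs : Vec (PR n) m) (xs : Vec Tree n) →
                mapᵛ (λ h → fapp h (codes xs)) hs ≋ codes (evalAll hs xs)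
    evalAll-≋ []       xs = ≋-refl []
    evalAll-≋ (h ∷ hs) xs = eval-≈ h xs ∷≋ evalAll-≋ hs xs

    evalRec-≈ : ∀ {n} (gs : (i : Con) → PR (arity i + (arity i + n))) (ys : Vec Tree n) (x : Tree) →
                fapp (rec gs) (code x ∷ codes ys) ≈ code (evalRec gs ys x)
    evalRec-≈ {n} gs ys (node i zs) =
      ≈-trans (fapp-rec gs i (codes zs) (codes ys))
        (≈-trans (≈-cong (inj₂ (arity i + (arity i + n) , gs i)) arguments)
                 (eval-≈ (gs i) (zs ++ᵛ (recAll gs ys zs ++ᵛ ys))))
      where
        codes-args : codes (zs ++ᵛ (recAll gs ys zs ++ᵛ ys)) ≡ codes zs ++ᵛ (codes (recAll gs ys zs) ++ᵛ codes ys)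
        codes-args = trans (codes-++ zs _) (cong (codes zs ++ᵛ_) (codes-++ (recAll gs ys zs) ys))
        recursive-calls = mapᵛ (λ z → fapp (rec gs) (z ∷ codes ys)) (codes zs)
        arguments : codes zs ++ᵛ (recursive-calls ++ᵛ codes ys) ≋ codes (zs ++ᵛ (recAll gs ys zs ++ᵛ ys))
        arguments = subst (_≋_ (codes zs ++ᵛ (recursive-calls ++ᵛ codes ys))) (sym codes-args)
                          (≋-++ (≋-refl (codes zs)) (≋-++ (recAll-≋ gs ys zs) (≋-refl (codes ys))))

    recAll-≋ : ∀ {n k} (gs : (i : Con) → PR (arity i + (arity i + n))) (ys : Vec Tree n) (zs : Vec Tree k) →
               mapᵛ (λ z → fapp (rec gs) (z ∷ codes ys)) (codes zs) ≋ codes (recAll gs ys zs)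
    recAll-≋ gs ys []       = ≋-refl []
    recAll-≋ gs ys (z ∷ zs) = evalRec-≈ gs ys z ∷≋ recAll-≋ gs ys zs

  codeRApp-≡ : ∀ {n} (f : PR n) (ts : Vec Tree n) → Coded.codeRApp I f ts ≡ trF (fapp f (codes ts) ≐ code oneT)
  codeRApp-≡ {n} f ts = begin
    UU.subF (UU.tmsSub (trTs (vecTms (codes ts)))) (trF (RForm f))
      ≡⟨ UL.subF-cong (λ w → sym (trSub-tmsSub (vecTms (codes ts)) w)) (trF (RForm f)) ⟩
    UU.subF (trSub (vecSub (codes ts))) (trF (RForm f))
      ≡⟨ trF-subF (vecSub (codes ts)) {RForm f} qf-atom ⟩
    trF (subT (vecSub (codes ts)) (fapp f (vars n)) ≐ code oneT)
      ≡⟨ cong (λ a → trF (a ≐ code oneT)) (gapp-vars-vecSub (inj₂ (n , f)) (codes ts)) ⟩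
    trF (fapp f (codes ts) ≐ code oneT)
      ∎
    where open ≡-Reasoning

  module _ (consistent : Consistent U) where
    mutual
      code-injective : ∀ {t₁ t₂} → code t₁ ≈ code t₂ → t₁ ≡ t₂
      code-injective {node i xs} {node j ys} e with i ≟ j
      ... | no  i≢j  = contradiction (capp-disjoint i j i≢j e) consistent
      ... | yes refl = cong (node i) (codes-injective (capp-injective i e))

      codes-injective : ∀ {n} {xs ys : Vec Tree n} → codes xs ≋ codes ys → xs ≡ ys
      codes-injective {xs = []}    {[]}    _       = refl
      codes-injective {xs = _ ∷ _} {_ ∷ _} (mk≋ e) =
        cong₂ _∷_ (code-injective (mk≈ (∧E₁ e))) (codes-injective (mk≋ (∧E₂ e)))

    equality-represented : (t₁ t₂ : Tree) → (t₁ ≡ t₂) ⇔ (U ⊢ Coded.codeEq I t₁ t₂)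
    equality-represented t₁ t₂ =
      mk⇔ (λ { refl → un≈ (≈-refl (code t₁)) }) (λ d → code-injective {t₁} {t₂} (mk≈ d))

    characteristic-represented : ∀ {n} {f : PR n} → IsCharacteristic f → (ts : Vec Tree n) →
                                 (eval f ts ≡ oneT) ⇔ (U ⊢ Coded.codeRApp I f ts)
    characteristic-represented {f = f} χ ts = mk⇔ proves-R decided-by-R
      where
        evaluates-to : ∀ {t} → eval f ts ≡ t → fapp f (codes ts) ≈ code t
        evaluates-to refl = eval-≈ f ts

        proves-R : eval f ts ≡ oneT → U ⊢ Coded.codeRApp I f ts
        proves-R value = subst (U ⊢_) (sym (codeRApp-≡ f ts)) (un≈ (evaluates-to value))

        proves-one : U ⊢ Coded.codeRApp I f ts → fapp f (codes ts) ≈ code oneT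
        proves-one d = mk≈ (subst (U ⊢_) (codeRApp-≡ f ts) d)

        decided-by-R : U ⊢ Coded.codeRApp I f ts → eval f ts ≡ oneT
        decided-by-R d with χ ts
        ... | inj₂ value = value
        ... | inj₁ value =
          contradiction (code-injective (≈-trans (≈-sym (evaluates-to value)) (proves-one d))) λ ()

proposition2 : (L : TreeLang) (U : Theory)
    (I : Interpretation (Trees.SSig L) (Trees.AxS L) U) →
    Consistent U →
    ((n : ℕ) (f : Trees.PR L n) → Trees.IsCharacteristic L f →
      (ts : Vec (Trees.Tree L) n) →
      (Trees.eval L f ts ≡ Trees.oneT L) ⇔ (U ⊢ Trees.Coded.codeRApp L I f ts))
    × ((t₁ t₂ : Trees.Tree L) →
      (t₁ ≡ t₂) ⇔ (U ⊢ Trees.Coded.codeEq L I t₁ t₂))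
proposition2 L U I consistent =
  (λ n f χ → characteristic-represented consistent χ) , equality-represented consistent
  where open Representability L U I
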